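{- Let $n\geq 3$ and let $B$ be a trivial conditional matching preclusion set of the hypercube $Q_n$. Then $Q_n-B$ is connected.
   Context: The $n$-dimensional hypercube $Q_n$ has vertex set all binary strings $v_1v_2\ldots v_n$ with $v_i\in\{0,1\}$, two vertices being adjacent iff their strings differ in exactly one position. A perfect matching covers all vertices; an almost perfect matching covers all but one vertex. A conditional matching preclusion set of a graph $G$ is a set $S\subseteq E(G)$ such that $G-S$ has no isolated vertices and has neither a perfect matching nor an almost perfect matching. A conditional matching preclusion set $S$ of $Q_n$ is called trivial if there is a 2-path $uwv$ in $Q_n$ with $uw,wv\notin S$ such that every edge of $S$ is incident to $u$ or to $v$. -}

module Defs where

open import Data.Bool using (Bool; true; false; _≟_)
open import Data.Nat using (ℕ; zero; suc)
open import Data.Vec using (Vec; []; _∷_)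
open import Data.Product using (Σ; _×_; _,_; ∃)
open import Data.Sum using (_⊎_)
open import Relation.Nullary using (¬_; yes; no)
open import Relation.Binary.PropositionalEquality using (_≡_; _≢_)

Vertex : ℕ → Set
Vertex n = Vec Bool n

hamming : ∀ {n} → Vertex n → Vertex n → ℕ
hamming [] [] = zero
hamming (a ∷ u) (b ∷ v) with a ≟ b
... | yes _ = hamming u v
... | no  _ = suc (hamming u v)

Adj : ∀ {n} → Vertex n → Vertex n → Set
Adj u v = hamming u v ≡ 1

-- A set of edges, given (decidably) as a Boolean predicate on ordered
-- pairs of vertices; the undirected edge uv belongs to S iff S u v or S v u.
EdgeSet : ℕ → Set
EdgeSet n = Vertex n → Vertex n → Bool

_∈E_ : ∀ {n} → Vertex n × Vertex n → EdgeSet n → Set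
(u , v) ∈E S = (S u v ≡ true) ⊎ (S v u ≡ true)

SubsetOfEdges : ∀ {n} → EdgeSet n → Set
SubsetOfEdges {n} S = ∀ (u v : Vertex n) → S u v ≡ true → Adj u v

EdgeOf- : ∀ {n} → EdgeSet n → Vertex n → Vertex n → Set
EdgeOf- S u v = Adj u v × ¬ ((u , v) ∈E S)

IsMatching : ∀ {n} → EdgeSet n → EdgeSet n → Set
IsMatching {n} S M =
  (∀ (u v : Vertex n) → M u v ≡ true → EdgeOf- S u v) ×
  (∀ (u v w : Vertex n) → (u , v) ∈E M → (u , w) ∈E M → v ≡ w)

Covers : ∀ {n} → EdgeSet n → Vertex n → Set
Covers {n} M v = Σ (Vertex n) λ w → (v , w) ∈E M

HasPerfectMatching : ∀ {n} → EdgeSet n → Set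
HasPerfectMatching {n} S =
  Σ (EdgeSet n) λ M → IsMatching S M × (∀ (v : Vertex n) → Covers M v)

HasAlmostPerfectMatching : ∀ {n} → EdgeSet n → Set
HasAlmostPerfectMatching {n} S =
  Σ (EdgeSet n) λ M → IsMatching S M ×
    Σ (Vertex n) λ x → ¬ Covers M x × (∀ (v : Vertex n) → v ≢ x → Covers M v)

NoIsolated : ∀ {n} → EdgeSet n → Set
NoIsolated {n} S = ∀ (v : Vertex n) → Σ (Vertex n) λ w → EdgeOf- S v w

IsCondMatchingPreclusionSet : ∀ {n} → EdgeSet n → Set
IsCondMatchingPreclusionSet S =
  SubsetOfEdges S × NoIsolated S ×
  ¬ HasPerfectMatching S × ¬ HasAlmostPerfectMatching S

IsTrivial : ∀ {n} → EdgeSet n → Set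
IsTrivial {n} S =
  Σ (Vertex n) λ u → Σ (Vertex n) λ w → Σ (Vertex n) λ v →
    Adj u w × Adj w v × u ≢ v ×
    ¬ ((u , w) ∈E S) × ¬ ((w , v) ∈E S) ×
    (∀ (a b : Vertex n) → S a b ≡ true →
       (a ≡ u ⊎ a ≡ v) ⊎ (b ≡ u ⊎ b ≡ v))

data Reach {n : ℕ} (S : EdgeSet n) : Vertex n → Vertex n → Set where
  here : ∀ {x} → Reach S x x
  step : ∀ {x y z} → EdgeOf- S x y → Reach S y z → Reach S x z

Connected- : ∀ {n} → EdgeSet n → Set
Connected- {n} S = ∀ (x y : Vertex n) → Reach S x y

module Submission where

-- Let B be trivial, witnessed by the 2-path u w v: every edge
-- of B meets u or v, while uw and wv survive.  Hence Q_n - B contains the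
-- whole subgraph of Q_n induced by the vertices other than u and v, and it
-- suffices to show that Q_n with two vertices deleted stays connected for
-- n ≥ 3; u and v are then joined to the rest through w.
--
-- Q_n splits into the two halves
-- b ∷ _ (b : Bool), copies of Q_{n-1} joined by a perfect matching.  From
-- this we get, in turn:
--   * Q_n is connected;
--   * if one half lies entirely in G, the subgraph induced by G is connected;
--   * Q_n minus one vertex is connected (the other half is untouched);
--   * Q_n minus two vertices is connected for n ≥ 3 (either one half is
--     untouched, or each half is a once-punctured cube and the halves are
--     joined by a matching edge avoiding both punctures).
-- The theorem follows by routing every vertex to w.

open import Defs
open import Data.Bool using (Bool; true; false; not; _≟_)
open import Data.Bool.Properties using (not-¬; ¬-not)
open import Data.Empty using (⊥-elim)
open import Data.Nat using (ℕ; _≥_; suc; s≤s)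
open import Data.Nat.Properties using (0≢1+n)
open import Data.Vec using (_∷_; []; tail)
open import Data.Vec.Properties using (∷-injectiveˡ; ∷-injectiveʳ; ≡-dec)
open import Data.Product using (Σ; _×_; _,_)
open import Data.Sum using (_⊎_; inj₁; inj₂; [_,_]; swap)
open import Level using (0ℓ)
open import Relation.Binary using (Rel; _⇒_)
open import Relation.Binary.Construct.Closure.ReflexiveTransitive
  using (Star; ε; _◅_; _◅◅_; gmap; map; fold; reverse)
open import Relation.Nullary using (¬_; yes; no)
open import Relation.Binary.PropositionalEquality
  using (_≡_; _≢_; refl; sym; trans; cong; ≢-sym)

hamming-refl : ∀ {n} (x : Vertex n) → hamming x x ≡ 0
hamming-refl []          = refl
hamming-refl (true ∷ x)  = hamming-refl x
hamming-refl (false ∷ x) = hamming-refl x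

hamming-sym : ∀ {n} (x y : Vertex n) → hamming x y ≡ hamming y x
hamming-sym []          []          = refl
hamming-sym (true ∷ x)  (true ∷ y)  = hamming-sym x y
hamming-sym (true ∷ x)  (false ∷ y) = cong suc (hamming-sym x y)
hamming-sym (false ∷ x) (true ∷ y)  = cong suc (hamming-sym x y)
hamming-sym (false ∷ x) (false ∷ y) = hamming-sym x y

Adj-sym : ∀ {n} {x y : Vertex n} → Adj x y → Adj y x
Adj-sym {x = x} {y} x~y = trans (hamming-sym y x) x~y

Adj-irrefl : ∀ {n} {x y : Vertex n} → Adj x y → x ≢ y
Adj-irrefl {x = x} x~y refl = 0≢1+n (trans (sym (hamming-refl x)) x~y)

Adj-cons : ∀ {n} (b : Bool) {x y : Vertex n} → Adj x y → Adj (b ∷ x) (b ∷ y)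
Adj-cons true  x~y = x~y
Adj-cons false x~y = x~y

Adj-across : ∀ {n} {a b : Bool} → a ≢ b → (x : Vertex n) → Adj (a ∷ x) (b ∷ x)
Adj-across {a = true}  {true}  a≢b _ = ⊥-elim (a≢b refl)
Adj-across {a = false} {false} a≢b _ = ⊥-elim (a≢b refl)
Adj-across {a = true}  {false} _   x = cong suc (hamming-refl x)
Adj-across {a = false} {true}  _   x = cong suc (hamming-refl x)

heads-differ : ∀ {n} {a b : Bool} {x y : Vertex n} → a ≢ b → (a ∷ x) ≢ (b ∷ y)
heads-differ a≢b e = a≢b (∷-injectiveˡ e)

tails-differ : ∀ {n} {a b : Bool} {x y : Vertex n} → x ≢ y → (a ∷ x) ≢ (b ∷ y)
tails-differ x≢y e = x≢y (∷-injectiveʳ e)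

bool-other : ∀ {c d : Bool} → c ≢ d → (a : Bool) → a ≡ c ⊎ a ≡ d
bool-other {c} c≢d a with a ≟ c
... | yes a≡c = inj₁ a≡c
... | no  a≢c = inj₂ (trans (¬-not a≢c) (sym (¬-not (≢-sym c≢d))))

avoid-two : ∀ {m} (p q : Vertex (suc (suc m))) →
  Σ (Vertex (suc (suc m))) λ x → x ≢ p × x ≢ q
avoid-two (p₁ ∷ _ ∷ _) (_ ∷ q₂ ∷ r) =
  (not p₁ ∷ not q₂ ∷ r) ,
  heads-differ (≢-sym (not-¬ refl)) ,
  (λ e → heads-differ (≢-sym (not-¬ refl)) (∷-injectiveʳ e))

Induced : ∀ {n} → (Vertex n → Set) → Rel (Vertex n) 0ℓ
Induced G x y = G x × G y × Adj x y

Walk : ∀ {n} → (Vertex n → Set) → Rel (Vertex n) 0ℓ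
Walk G = Star (Induced G)

Walk-sym : ∀ {n} {G : Vertex n → Set} {x y} → Walk G x y → Walk G y x
Walk-sym {G = G} = reverse Induced-sym
  where
  Induced-sym : ∀ {x y} → Induced G x y → Induced G y x
  Induced-sym {x} {y} (gx , gy , x~y) = gy , gx , Adj-sym {x = x} {y} x~y

lift-walk : ∀ {n} {G : Vertex (suc n) → Set} (b : Bool) {x y : Vertex n} →
  Walk (λ z → G (b ∷ z)) x y → Walk G (b ∷ x) (b ∷ y)
lift-walk b = gmap (b ∷_) λ (gx , gy , x~y) → gx , gy , Adj-cons b x~y

-- Q_n is connected, and more generally: if the whole half b ∷ _ lies in G,
-- every vertex of G reaches every vertex of that half (cross over if
-- needed, then walk inside the half, a copy of the connected Q_{n-1}).
cube-connected : ∀ {n} {G : Vertex n → Set} → (∀ z → G z) → ∀ x y → Walk G x y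
reach-full-half : ∀ {n} {G : Vertex (suc n) → Set} (b : Bool) →
  (∀ z → G (b ∷ z)) → ∀ x → G x → (h : Vertex n) → Walk G x (b ∷ h)

cube-connected all []      []      = ε
cube-connected all (a ∷ x) (b ∷ y) = reach-full-half b (λ z → all (b ∷ z)) (a ∷ x) (all _) y

reach-full-half b full (a ∷ x) gx h with a ≟ b
... | yes refl = lift-walk b (cube-connected full x h)
... | no a≢b   = (gx , full x , Adj-across a≢b x) ◅ lift-walk b (cube-connected full x h)

connected-via-full-half : ∀ {n} {G : Vertex (suc n) → Set} (b : Bool) →
  (∀ z → G (b ∷ z)) → ∀ x y → G x → G y → Walk G x y
connected-via-full-half b full x y gx gy =
  reach-full-half b full x gx (tail x) ◅◅ Walk-sym (reach-full-half b full y gy (tail x))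

-- Q_n minus one vertex p is connected: the half not containing p is full.
punctured-connected : ∀ {n} {G : Vertex n → Set} (p : Vertex n) →
  (∀ z → z ≢ p → G z) → ∀ x y → G x → G y → Walk G x y
punctured-connected []      _   []  []  _ _ = ε
punctured-connected (c ∷ _) off x y gx gy =
  connected-via-full-half (not c) (λ z → off _ (heads-differ (≢-sym (not-¬ refl)))) x y gx gy

-- Q_n minus vertices c ∷ p and d ∷ q in opposite halves (n ≥ 3): each half
-- is a once-punctured Q_{n-1}, and the two halves are joined by the matching
-- edge at a vertex x₀ of Q_{n-1} different from p and q.
opposite-punctures-connected : ∀ {m} {G : Vertex (suc (suc (suc m))) → Set}
  {c d : Bool} (p q : Vertex (suc (suc m))) → c ≢ d →
  (∀ z → z ≢ c ∷ p → z ≢ d ∷ q → G z) → ∀ x y → G x → G y → Walk G x y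
opposite-punctures-connected {G = G} {c} {d} p q c≢d off x y gx gy
  with avoid-two p q
... | x₀ , x₀≢p , x₀≢q = to-hub x gx ◅◅ Walk-sym (to-hub y gy)
  where
  in-c : ∀ z → z ≢ p → G (c ∷ z)
  in-c z z≢p = off _ (tails-differ z≢p) (heads-differ c≢d)
  in-d : ∀ z → z ≢ q → G (d ∷ z)
  in-d z z≢q = off _ (heads-differ (≢-sym c≢d)) (tails-differ z≢q)
  to-hub : ∀ x → G x → Walk G x (c ∷ x₀)
  to-hub (a ∷ x) gx with bool-other c≢d a
  ... | inj₁ refl = lift-walk c (punctured-connected p in-c x x₀ gx (in-c x₀ x₀≢p))
  ... | inj₂ refl = lift-walk d (punctured-connected q in-d x x₀ gx (in-d x₀ x₀≢q))
                    ◅◅ ((in-d x₀ x₀≢q , in-c x₀ x₀≢p , Adj-across (≢-sym c≢d) x₀) ◅ ε)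

-- Q_n minus two vertices p and q is connected for n ≥ 3: if p and q lie in
-- the same half the other half is full, otherwise use the matching edge.
twice-punctured-connected : ∀ {m} {G : Vertex (suc (suc (suc m))) → Set}
  (p q : Vertex (suc (suc (suc m)))) →
  (∀ z → z ≢ p → z ≢ q → G z) → ∀ x y → G x → G y → Walk G x y
twice-punctured-connected {m} (c ∷ p) (d ∷ q) off x y gx gy with c ≟ d
... | yes refl = connected-via-full-half (not c) (λ z → off _ not-c not-c) x y gx gy
  where
  not-c : ∀ {z r : Vertex (suc (suc m))} → (not c ∷ z) ≢ (c ∷ r)
  not-c = heads-differ (≢-sym (not-¬ refl))
... | no c≢d   = opposite-punctures-connected p q c≢d off x y gx gy

to-reach : ∀ {n} {S : EdgeSet n} {x y} → Star (EdgeOf- S) x y → Reach S x y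
to-reach {S = S} = fold (Reach S) step here

EdgeOf-sym : ∀ {n} (S : EdgeSet n) {x y} → EdgeOf- S x y → EdgeOf- S y x
EdgeOf-sym _ {x} {y} (x~y , xy∉S) = Adj-sym {x = x} {y} x~y , λ yx∈S → xy∉S (swap yx∈S)

Avoiding : ∀ {n} → Vertex n → Vertex n → Vertex n → Set
Avoiding u v z = z ≢ u × z ≢ v

induced-survives : ∀ {n} {S : EdgeSet n} {u v : Vertex n} →
  (∀ a b → S a b ≡ true → (a ≡ u ⊎ a ≡ v) ⊎ (b ≡ u ⊎ b ≡ v)) →
  Induced (Avoiding u v) ⇒ EdgeOf- S
induced-survives {u = u} {v} incident {x} {y} (x-ok , y-ok , x~y) =
  x~y , [ (λ e → misses x-ok y-ok (incident x y e))
        , (λ e → misses y-ok x-ok (incident y x e)) ]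
  where
  misses : ∀ {a b} → Avoiding u v a → Avoiding u v b →
    ¬ ((a ≡ u ⊎ a ≡ v) ⊎ (b ≡ u ⊎ b ≡ v))
  misses (a≢u , a≢v) (b≢u , b≢v) = [ [ a≢u , a≢v ] , [ b≢u , b≢v ] ]

mainTheorem4 : (n : ℕ) → n ≥ 3 → (B : EdgeSet n) →
    IsCondMatchingPreclusionSet B → IsTrivial B → Connected- B
mainTheorem4 (suc (suc (suc m))) (s≤s (s≤s (s≤s _))) B _
  (u , w , v , u~w , w~v , _ , uw∉B , wv∉B , incident) x y =
  to-reach (to-w x ◅◅ reverse (EdgeOf-sym B) (to-w y))
  where
  w-ok : Avoiding u v w
  w-ok = ≢-sym (Adj-irrefl u~w) , Adj-irrefl w~v
  to-w : ∀ x → Star (EdgeOf- B) x w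
  to-w x with ≡-dec _≟_ x u | ≡-dec _≟_ x v
  ... | yes refl | _        = (u~w , uw∉B) ◅ ε
  ... | no _     | yes refl = EdgeOf-sym B {w} (w~v , wv∉B) ◅ ε
  ... | no x≢u   | no x≢v   =
    map (induced-survives incident)
        (twice-punctured-connected u v (λ _ z≢u z≢v → z≢u , z≢v) x w (x≢u , x≢v) w-ok)
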